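{- Let $p$ and $q$ be distinct odd primes, let $a,b$ be nonnegative integers, and set $c=\lfloor(a+1)/(b+2)\rfloor$. If $q<p^c$, then $p^aq^b$ reduces to $p^{a-c}q^{b+1}$.
   Context: For $n\in\mathbb{N}$, $\mathcal{D}(n)$ is the set of positive divisors of $n$; $\lambda(n)$ is the least prime factor of $n$ if $n\ge2$, and $\lambda(1)=1$. For $m,n\in\mathbb{N}$, a function $f:\mathcal{D}(n)\to\mathcal{D}(m)$ is reducing if for all $d,d'\in\mathcal{D}(n)$: (a) $f(d)\le d$; (b) $\frac{m/f(d)}{n/d}\le\min\left\{1,\frac{\lambda(m/f(d))}{\lambda(n/d)}\right\}$; (c) if $f(d)=2^if(d')$ for some $i\in\mathbb{Z}$, then $d=2^jd'$ for some $j\in\mathbb{Z}$. We say $n$ reduces to $m$ if a reducing function $\mathcal{D}(n)\to\mathcal{D}(m)$ exists. -}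

module Defs where

open import Data.Nat using (ℕ; zero; suc; _+_; _*_; _^_; _≤_; _<_)
open import Data.Nat.Divisibility using (_∣_; _∣?_; quotient)
open import Data.Product using (Σ; _×_; ∃₂; proj₁; proj₂)
open import Relation.Nullary.Decidable using (does)
open import Data.Bool using (if_then_else_)
open import Relation.Binary.PropositionalEquality using (_≡_)

𝒟 : ℕ → Set
𝒟 n = Σ ℕ λ d → (0 < d) × (d ∣ n)

val : ∀ {n} → 𝒟 n → ℕ
val = proj₁

co : ∀ {n} → 𝒟 n → ℕ
co x = quotient (proj₂ (proj₂ x))

lpfFrom : ℕ → ℕ → ℕ → ℕ
lpfFrom zero     k n = n
lpfFrom (suc fu) k n = if does (k ∣? n) then k else lpfFrom fu (suc k) n

-- λ(n): least prime factor of n for n ≥ 2 (= least divisor ≥ 2), λ(1) = 1.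
-- (λ(0) is irrelevant: only positive arguments occur.)
lpf : ℕ → ℕ
lpf zero          = zero
lpf (suc zero)    = 1
lpf (suc (suc n)) = lpfFrom (suc n) 2 (suc (suc n))

-- "x = 2^i y for some integer i"  ⇔  2^j x = 2^k y for some naturals j, k
Pow2Related : ℕ → ℕ → Set
Pow2Related x y = ∃₂ λ j k → 2 ^ j * x ≡ 2 ^ k * y

-- Reducing functions 𝒟(n) → 𝒟(m).
-- Condition (b): with A = m/f(d) and B = n/d (positive naturals),
--   A/B ≤ min{1, λ(A)/λ(B)}  ⇔  A ≤ B  and  A·λ(B) ≤ λ(A)·B.
record IsReducing (n m : ℕ) (f : 𝒟 n → 𝒟 m) : Set where
  field
    cond-a : ∀ d → val (f d) ≤ val d
    cond-b₁ : ∀ d → co (f d) ≤ co d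
    cond-b₂ : ∀ d → co (f d) * lpf (co d) ≤ lpf (co (f d)) * co d
    cond-c : ∀ d d' → Pow2Related (val (f d)) (val (f d')) →
             Pow2Related (val d) (val d')

_reducesTo_ : ℕ → ℕ → Set
n reducesTo m = Σ (𝒟 n → 𝒟 m) (IsReducing n m)

-- Write a divisor of n = pᵃqᵇ as pⁱqʲ and give it the weight i + cj.  Divisors of weight at
-- least c(b+1) are multiplied by q/pᶜ, the others are kept.  Multiplication by q/pᶜ preserves
-- the weight, so the two classes have disjoint images and the map is injective; its values
-- divide the odd number m, so condition (c) reduces to injectivity.  For a shifted divisor the
-- complementary divisor is unchanged; for a kept one it becomes A with A pᶜ = k q, so p ∣ k,
-- q ∣ A, λ(k) ≤ p and λ(A) ≥ min(p, q), and (b) follows from q < pᶜ.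
module Submission where

open import Defs
open import Data.Nat
  using (ℕ; zero; suc; _+_; _*_; _^_; _∸_; _<_; _≤_; _/_; _%_; z≤n; s≤s; NonZero; >-nonZero; >-nonZero⁻¹; nonTrivial⇒n>1; _≤?_)
open import Data.Nat.Properties
open import Data.Nat.Divisibility
open import Data.Nat.DivMod using (%-distribˡ-*; m%n<n; m*n%n≡0; m/n*n≤m)
open import Data.Nat.Primality using (Prime; prime⇒nonZero; prime⇒nonTrivial; prime⇒irreducible; euclidsLemma)
open import Data.Nat.Coprimality using (Coprime; coprime-divisor)
open import Data.Product using (∃; ∃₂; _×_; _,_; proj₂)
open import Data.Sum using (_⊎_; inj₁; inj₂)
open import Relation.Binary.Definitions using (tri<; tri≈; tri>)
open import Relation.Nullary using (¬_; Dec; yes; no; contradiction)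
open import Relation.Binary.PropositionalEquality
open import Algebra.Properties.CommutativeSemigroup *-commutativeSemigroup using (xy∙z≈xz∙y)

prime⇒1< : ∀ {p} → Prime p → 1 < p
prime⇒1< {p} p-prime = nonTrivial⇒n>1 p {{prime⇒nonTrivial p-prime}}

prime∣prime⇒≡ : ∀ {p q} → Prime p → Prime q → p ∣ q → p ≡ q
prime∣prime⇒≡ p-prime q-prime p∣q with prime⇒irreducible q-prime p∣q
... | inj₁ p≡1 = contradiction p≡1 (>⇒≢ (prime⇒1< p-prime))
... | inj₂ p≡q = p≡q

prime∣^⇒≡ : ∀ {p q} j → Prime p → Prime q → p ∣ q ^ j → p ≡ q
prime∣^⇒≡ zero p-prime _ p∣1 = contradiction (∣1⇒≡1 p∣1) (>⇒≢ (prime⇒1< p-prime))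
prime∣^⇒≡ {q = q} (suc j) p-prime q-prime p∣q^[1+j] with euclidsLemma q (q ^ j) p-prime p∣q^[1+j]
... | inj₁ p∣q   = prime∣prime⇒≡ p-prime q-prime p∣q
... | inj₂ p∣q^j = prime∣^⇒≡ j p-prime q-prime p∣q^j

prime∤⇒coprime : ∀ {p d} → Prime p → ¬ p ∣ d → Coprime d p
prime∤⇒coprime p-prime p∤d (e∣d , e∣p) with prime⇒irreducible p-prime e∣p
... | inj₁ e≡1 = e≡1
... | inj₂ refl = contradiction e∣d p∤d

m∣m^n : ∀ m {n} → n ≢ 0 → m ∣ m ^ n
m∣m^n m {zero}  n≢0 = contradiction refl n≢0
m∣m^n m {suc n} _   = m∣m*n (m ^ n)

^-injectiveʳ : ∀ {q} → 1 < q → ∀ {j l} → q ^ j ≡ q ^ l → j ≡ l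
^-injectiveʳ {q} 1<q {j} {l} eq with <-cmp j l
... | tri< j<l _ _ = contradiction eq (<⇒≢ (^-monoʳ-< q 1<q j<l))
... | tri≈ _ j≡l _ = j≡l
... | tri> _ _ l<j = contradiction eq (>⇒≢ (^-monoʳ-< q 1<q l<j))

∣p*m⇒ : ∀ {p m d} → Prime p → d ∣ p * m → (∃ λ e → d ≡ p * e × e ∣ m) ⊎ d ∣ m
∣p*m⇒ {p} {m} {d} p-prime d∣pm with p ∣? d
... | yes (divides e refl) =
  inj₁ (e , *-comm e p , *-cancelʳ-∣ p {{prime⇒nonZero p-prime}} (subst (e * p ∣_) (*-comm p m) d∣pm))
... | no p∤d = inj₂ (coprime-divisor (prime∤⇒coprime p-prime p∤d) d∣pm)

∣p^a*m⇒ : ∀ {p m} a {d} → Prime p → d ∣ p ^ a * m → ∃₂ λ i e → i ≤ a × e ∣ m × d ≡ p ^ i * e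
∣p^a*m⇒ {m = m} zero {d} _ d∣m = 0 , d , z≤n , subst (d ∣_) (*-identityˡ m) d∣m , sym (*-identityˡ d)
∣p^a*m⇒ {p} {m} (suc a) {d} p-prime d∣ with ∣p*m⇒ p-prime (subst (d ∣_) (*-assoc p (p ^ a) m) d∣)
... | inj₁ (d' , refl , d'∣) with ∣p^a*m⇒ a p-prime d'∣
...   | i , e , i≤a , e∣m , refl = suc i , e , s≤s i≤a , e∣m , sym (*-assoc p (p ^ i) e)
∣p^a*m⇒ (suc a) p-prime d∣ | inj₂ d∣' with ∣p^a*m⇒ a p-prime d∣'
...   | i , e , i≤a , e∣m , d≡ = i , e , m≤n⇒m≤1+n i≤a , e∣m , d≡

record Exponents (p q a b d : ℕ) : Set where
  constructor exponents
  field
    i j : ℕ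
    i≤a : i ≤ a
    j≤b : j ≤ b
    d≡pⁱqʲ : d ≡ p ^ i * q ^ j

∣pᵃqᵇ⇒exponents : ∀ {p q a b d} → Prime p → Prime q → d ∣ p ^ a * q ^ b → Exponents p q a b d
∣pᵃqᵇ⇒exponents {p} {q} {a} {b} p-prime q-prime d∣ with ∣p^a*m⇒ a p-prime d∣
... | i , e , i≤a , e∣qᵇ , refl with ∣p^a*m⇒ b q-prime (subst (e ∣_) (sym (*-identityʳ (q ^ b))) e∣qᵇ)
...   | j , u , j≤b , u∣1 , refl rewrite ∣1⇒≡1 u∣1 =
  exponents i j i≤a j≤b (cong (p ^ i *_) (*-identityʳ (q ^ j)))

pⁱqʲ-injective : ∀ {p q} → Prime p → Prime q → p ≢ q →
                 ∀ i j k l → p ^ i * q ^ j ≡ p ^ k * q ^ l → i ≡ k × j ≡ l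
pⁱqʲ-injective {p} {q} p-prime q-prime p≢q = go
  where
  instance _ = prime⇒nonZero p-prime

  qʲ≢p^[1+k]qˡ : ∀ j k l → q ^ j ≢ p ^ suc k * q ^ l
  qʲ≢p^[1+k]qˡ j k l eq =
    p≢q (prime∣^⇒≡ j p-prime q-prime (divides (p ^ k * q ^ l) (trans eq (trans (*-assoc p _ _) (*-comm p _)))))

  go : ∀ i j k l → p ^ i * q ^ j ≡ p ^ k * q ^ l → i ≡ k × j ≡ l
  go zero    j zero    l eq =
    refl , ^-injectiveʳ (prime⇒1< q-prime) (trans (sym (*-identityˡ _)) (trans eq (*-identityˡ _)))
  go zero    j (suc k) l eq = contradiction (trans (sym (*-identityˡ _)) eq) (qʲ≢p^[1+k]qˡ j k l)
  go (suc i) j zero    l eq = contradiction (trans (sym (*-identityˡ _)) (sym eq)) (qʲ≢p^[1+k]qˡ l i j)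
  go (suc i) j (suc k) l eq with go i j k l (*-cancelˡ-≡ _ _ p (trans (sym (*-assoc p _ _)) (trans eq (*-assoc p _ _))))
  ... | refl , j≡l = refl , j≡l

∣pᵃqᵇ⇒p∣⊎q∣ : ∀ {p q a b e} → Prime p → Prime q → 1 < e → e ∣ p ^ a * q ^ b → p ∣ e ⊎ q ∣ e
∣pᵃqᵇ⇒p∣⊎q∣ {p} {q} {a} {b} p-prime q-prime 1<e e∣ with ∣pᵃqᵇ⇒exponents {a = a} {b = b} p-prime q-prime e∣
... | exponents (suc i) j _ _ refl = inj₁ (∣-trans (m∣m*n (p ^ i)) (m∣m*n (q ^ j)))
... | exponents zero (suc j) _ _ refl = inj₂ (∣-trans (m∣m*n (q ^ j)) (n∣m*n 1))
... | exponents zero zero _ _ refl = contradiction 1<e (<-irrefl refl)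

Odd : ℕ → Set
Odd x = x % 2 ≡ 1

odd-* : ∀ x y → Odd x → Odd y → Odd (x * y)
odd-* x y x-odd y-odd = trans (%-distribˡ-* x y 2) (cong₂ (λ u v → (u * v) % 2) x-odd y-odd)

odd-^ : ∀ x n → Odd x → Odd (x ^ n)
odd-^ x zero    _     = refl
odd-^ x (suc n) x-odd = odd-* x (x ^ n) x-odd (odd-^ x n x-odd)

¬odd-2* : ∀ x → ¬ Odd (2 * x)
¬odd-2* x odd = contradiction (trans (sym odd) (trans (cong (_% 2) (*-comm 2 x)) (m*n%n≡0 x 2))) λ ()

∣-odd : ∀ {d x} → d ∣ x → Odd x → Odd d
∣-odd {d} (divides k refl) kd-odd with d % 2 | m%n<n d 2 | %-distribˡ-* k d 2
... | 0           | _               | eq = contradiction (trans (sym kd-odd) (trans eq (cong (_% 2) (*-zeroʳ (k % 2))))) λ ()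
... | 1           | _               | _  = refl
... | suc (suc _) | s≤s (s≤s ())    | _

odd-pow2Related⇒≡ : ∀ {x y} → Odd x → Odd y → Pow2Related x y → x ≡ y
odd-pow2Related⇒≡ {x} {y} x-odd y-odd (j , k , eq) = go j k eq
  where
  go : ∀ j k → 2 ^ j * x ≡ 2 ^ k * y → x ≡ y
  go zero    zero    eq = trans (sym (*-identityˡ x)) (trans eq (*-identityˡ y))
  go zero    (suc k) eq =
    contradiction (subst Odd (trans (sym (*-identityˡ x)) (trans eq (*-assoc 2 (2 ^ k) y))) x-odd) (¬odd-2* (2 ^ k * y))
  go (suc j) zero    eq =
    contradiction (subst Odd (trans (sym (*-identityˡ y)) (trans (sym eq) (*-assoc 2 (2 ^ j) x))) y-odd) (¬odd-2* (2 ^ j * x))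
  go (suc j) (suc k) eq = go j k (*-cancelˡ-≡ _ _ 2 (trans (sym (*-assoc 2 (2 ^ j) x)) (trans eq (*-assoc 2 (2 ^ k) y))))

lpfFrom-∣ : ∀ fuel k N → lpfFrom fuel k N ∣ N
lpfFrom-∣ zero       k N = ∣-refl
lpfFrom-∣ (suc fuel) k N with k ∣? N
... | yes k∣N = k∣N
... | no  _   = lpfFrom-∣ fuel (suc k) N

lpfFrom-≥2 : ∀ fuel {k N} → 2 ≤ k → 2 ≤ N → 2 ≤ lpfFrom fuel k N
lpfFrom-≥2 zero       _   2≤N = 2≤N
lpfFrom-≥2 (suc fuel) {k} {N} 2≤k 2≤N with k ∣? N
... | yes _ = 2≤k
... | no  _ = lpfFrom-≥2 fuel (m≤n⇒m≤1+n 2≤k) 2≤N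

-- N ≤ k + fuel: the fuel suffices to reach N, so the fallback value is never returned early.
lpfFrom-minimal : ∀ fuel {k N e} → N ≤ k + fuel → k ≤ e → e ∣ N → lpfFrom fuel k N ≤ e
lpfFrom-minimal zero       {k} N≤k+0 k≤e _ = ≤-trans N≤k+0 (≤-trans (≤-reflexive (+-identityʳ k)) k≤e)
lpfFrom-minimal (suc fuel) {k} {N} {e} N≤k+1+fuel k≤e e∣N with k ∣? N
... | yes _   = k≤e
... | no  k∤N = lpfFrom-minimal fuel (≤-trans N≤k+1+fuel (≤-reflexive (+-suc k fuel)))
                  (≤∧≢⇒< k≤e λ { refl → k∤N e∣N }) e∣N

lpf∣ : ∀ N → lpf N ∣ N
lpf∣ zero          = ∣-refl
lpf∣ (suc zero)    = ∣-refl
lpf∣ (suc (suc n)) = lpfFrom-∣ (suc n) 2 (suc (suc n))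

2≤lpf : ∀ {N} → 2 ≤ N → 2 ≤ lpf N
2≤lpf {suc zero}    (s≤s ())
2≤lpf {suc (suc n)} 2≤N = lpfFrom-≥2 (suc n) ≤-refl 2≤N

lpf-minimal : ∀ {N e} → 2 ≤ e → e ∣ N → lpf N ≤ e
lpf-minimal {zero}          _   _   = z≤n
lpf-minimal {suc zero}      2≤e e∣1 = contradiction (∣1⇒≡1 e∣1) (>⇒≢ 2≤e)
lpf-minimal {suc (suc n)}   2≤e e∣N = lpfFrom-minimal (suc n) (n≤1+n _) 2≤e e∣N

co*val≡ : ∀ {n} (x : 𝒟 n) → co x * val x ≡ n
co*val≡ (_ , _ , x∣n) = sym (m∣n⇒n≡quotient*m x∣n)

val≢0 : ∀ {n} (x : 𝒟 n) → NonZero (val x)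
val≢0 (_ , 0<x , _) = >-nonZero 0<x

*-scaled-< : ∀ {x y q P} .{{_ : NonZero y}} → x * P ≡ y * q → q < P → x < y
*-scaled-< {x} {y} {q} {P} eq q<P = *-cancelʳ-< P x y (subst (_< y * P) (sym eq) (*-monoʳ-< y q<P))

module Reduction
  (p q a b c : ℕ) (p-prime : Prime p) (q-prime : Prime q) (p≢q : p ≢ q)
  (p-odd : Odd p) (q-odd : Odd q)
  (c[2+b]≤a+1 : c * (2 + b) ≤ a + 1) (q<pᶜ : q < p ^ c) where

  mono : ℕ → ℕ → ℕ
  mono i j = p ^ i * q ^ j

  n m : ℕ
  n = mono a b
  m = mono (a ∸ c) (b + 1)

  instance
    p≢0 : NonZero p
    p≢0 = prime⇒nonZero p-prime
    q≢0 : NonZero q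
    q≢0 = prime⇒nonZero q-prime
    pᶜ≢0 : NonZero (p ^ c)
    pᶜ≢0 = m^n≢0 p c

  mono≢0 : ∀ i j → NonZero (mono i j)
  mono≢0 i j = m*n≢0 (p ^ i) (q ^ j) {{m^n≢0 p i}} {{m^n≢0 q j}}

  instance
    n≢0 : NonZero n
    n≢0 = mono≢0 a b
    m≢0 : NonZero m
    m≢0 = mono≢0 (a ∸ c) (b + 1)

  c≢0 : c ≢ 0
  c≢0 refl = <⇒≱ q<pᶜ (<⇒≤ (prime⇒1< q-prime))

  c≤a : c ≤ a
  c≤a = +-cancelʳ-≤ 1 c a (begin
    c + 1         ≤⟨ +-monoʳ-≤ c (≤-trans (n≢0⇒n>0 c≢0) (m≤m*n c (suc b))) ⟩
    c + c * suc b ≡⟨ *-suc c (suc b) ⟨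
    c * (2 + b)   ≤⟨ c[2+b]≤a+1 ⟩
    a + 1         ∎)
    where open ≤-Reasoning

  mono-* : ∀ i j k l → mono i j * mono k l ≡ mono (i + k) (j + l)
  mono-* i j k l = trans ([m*n]*[o*p]≡[m*o]*[n*p] (p ^ i) (q ^ j) (p ^ k) (q ^ l))
                         (sym (cong₂ _*_ (^-distribˡ-+-* p i k) (^-distribˡ-+-* q j l)))

  mono∣mono : ∀ {i j k l} → i ≤ k → j ≤ l → mono i j ∣ mono k l
  mono∣mono {i} {j} {k} {l} i≤k j≤l =
    divides (mono (k ∸ i) (l ∸ j)) (sym (trans (mono-* (k ∸ i) (l ∸ j) i j) (cong₂ mono (m∸n+n≡m i≤k) (m∸n+n≡m j≤l))))

  mono-shift : ∀ i j → c ≤ i → mono (i ∸ c) (suc j) * p ^ c ≡ mono i j * q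
  mono-shift i j c≤i = begin
    mono (i ∸ c) (suc j) * p ^ c     ≡⟨ cong (mono (i ∸ c) (suc j) *_) (*-identityʳ (p ^ c)) ⟨
    mono (i ∸ c) (suc j) * mono c 0  ≡⟨ mono-* (i ∸ c) (suc j) c 0 ⟩
    mono (i ∸ c + c) (suc j + 0)     ≡⟨ cong₂ mono (trans (m∸n+n≡m c≤i) (sym (+-identityʳ i)))
                                                   (trans (+-identityʳ (suc j)) (+-comm 1 j)) ⟩
    mono (i + 0) (j + 1)             ≡⟨ mono-* i j 0 1 ⟨
    mono i j * mono 0 1              ≡⟨ cong (mono i j *_) (trans (*-identityˡ (q * 1)) (*-identityʳ q)) ⟩
    mono i j * q                     ∎
    where open ≡-Reasoning

  m*pᶜ≡n*q : m * p ^ c ≡ n * q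
  m*pᶜ≡n*q = trans (cong (λ t → mono (a ∸ c) t * p ^ c) (+-comm b 1)) (mono-shift a b c≤a)

  weight : ℕ → ℕ → ℕ
  weight i j = i + c * j

  weight-shift : ∀ i j → c ≤ i → weight (i ∸ c) (suc j) ≡ weight i j
  weight-shift i j c≤i = begin
    i ∸ c + c * suc j    ≡⟨ cong (i ∸ c +_) (*-suc c j) ⟩
    i ∸ c + (c + c * j)  ≡⟨ +-assoc (i ∸ c) c (c * j) ⟨
    i ∸ c + c + c * j    ≡⟨ cong (_+ c * j) (m∸n+n≡m c≤i) ⟩
    i + c * j            ∎
    where open ≡-Reasoning

  Heavy : ℕ → ℕ → Set
  Heavy i j = c * suc b ≤ weight i j

  heavy? : ∀ i j → Dec (Heavy i j)
  heavy? i j = c * suc b ≤? weight i j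

  heavy⇒c≤i : ∀ {i j} → j ≤ b → Heavy i j → c ≤ i
  heavy⇒c≤i {i} {j} j≤b heavy = ≮⇒≥ λ i<c → <⇒≱ (begin-strict
    i + c * j      <⟨ +-monoˡ-< (c * j) i<c ⟩
    c + c * j      ≡⟨ *-suc c j ⟨
    c * suc j      ≤⟨ *-monoʳ-≤ c (s≤s j≤b) ⟩
    c * suc b      ∎) heavy
    where open ≤-Reasoning

  light⇒i≤a∸c : ∀ {i j} → ¬ Heavy i j → i ≤ a ∸ c
  light⇒i≤a∸c {i} {j} light = m+n≤o⇒m≤o∸n i (m<1+n⇒m≤n (begin-strict
    i + c                ≤⟨ +-monoˡ-≤ c (m≤m+n i (c * j)) ⟩
    i + c * j + c        <⟨ +-monoˡ-< c (≰⇒> light) ⟩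
    c * suc b + c        ≡⟨ +-comm (c * suc b) c ⟩
    c + c * suc b        ≡⟨ *-suc c (suc b) ⟨
    c * (2 + b)          ≤⟨ c[2+b]≤a+1 ⟩
    a + 1                ≡⟨ +-comm a 1 ⟩
    suc a                ∎))
    where open ≤-Reasoning

  Exps : ℕ → Set
  Exps = Exponents p q a b

  IsHeavy : ∀ {d} → Exps d → Set
  IsHeavy (exponents i j _ _ _) = Heavy i j

  isHeavy? : ∀ {d} (e : Exps d) → Dec (IsHeavy e)
  isHeavy? (exponents i j _ _ _) = heavy? i j

  mono>0 : ∀ i j → 0 < mono i j
  mono>0 i j = >-nonZero⁻¹ (mono i j) {{mono≢0 i j}}

  image : ∀ {d} → Exps d → 𝒟 m
  image (exponents i j i≤a j≤b _) with heavy? i j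
  ... | yes _     = mono (i ∸ c) (suc j) , mono>0 (i ∸ c) (suc j) ,
                    mono∣mono (∸-monoˡ-≤ c i≤a) (≤-trans (s≤s j≤b) (≤-reflexive (+-comm 1 b)))
  ... | no  light = mono i j , mono>0 i j , mono∣mono (light⇒i≤a∸c light) (m≤n⇒m≤n+o 1 j≤b)

  image-heavy : ∀ {d} (e : Exps d) → IsHeavy e → val (image e) ≡ mono (Exponents.i e ∸ c) (suc (Exponents.j e))
  image-heavy (exponents i j _ _ _) heavy with heavy? i j
  ... | yes _     = refl
  ... | no  light = contradiction heavy light

  image-light : ∀ {d} (e : Exps d) → ¬ IsHeavy e → val (image e) ≡ d
  image-light (exponents i j _ _ d≡) light with heavy? i j
  ... | yes heavy = contradiction heavy light
  ... | no  _     = sym d≡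

  image-heavy-shift : ∀ {d} (e : Exps d) → IsHeavy e → val (image e) * p ^ c ≡ d * q
  image-heavy-shift {d} e@(exponents i j _ j≤b d≡) heavy = begin
    val (image e) * p ^ c         ≡⟨ cong (_* p ^ c) (image-heavy e heavy) ⟩
    mono (i ∸ c) (suc j) * p ^ c  ≡⟨ mono-shift i j (heavy⇒c≤i j≤b heavy) ⟩
    mono i j * q                  ≡⟨ cong (_* q) d≡ ⟨
    d * q                         ∎
    where open ≡-Reasoning

  heavy-image≢light : ∀ {d d'} (e : Exps d) (e' : Exps d') → IsHeavy e → ¬ IsHeavy e' → val (image e) ≢ d'
  heavy-image≢light e@(exponents i j _ j≤b _) (exponents i' j' _ _ refl) heavy light' eq
    with pⁱqʲ-injective p-prime q-prime p≢q (i ∸ c) (suc j) i' j' (trans (sym (image-heavy e heavy)) eq)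
  ... | refl , refl = light' (subst (c * suc b ≤_) (sym (weight-shift i j (heavy⇒c≤i j≤b heavy))) heavy)

  exps : (d : 𝒟 n) → Exps (val d)
  exps (_ , _ , d∣n) = ∣pᵃqᵇ⇒exponents p-prime q-prime d∣n

  f : 𝒟 n → 𝒟 m
  f d = image (exps d)

  co-heavy : (d : 𝒟 n) → IsHeavy (exps d) → co (f d) ≡ co d
  co-heavy d heavy = *-cancelʳ-≡ (co (f d)) (co d) (val (f d) * p ^ c) {{m*n≢0 _ _ {{val≢0 (f d)}}}} (begin
    co (f d) * (val (f d) * p ^ c)  ≡⟨ *-assoc (co (f d)) (val (f d)) (p ^ c) ⟨
    co (f d) * val (f d) * p ^ c    ≡⟨ cong (_* p ^ c) (co*val≡ (f d)) ⟩
    m * p ^ c                       ≡⟨ m*pᶜ≡n*q ⟩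
    n * q                           ≡⟨ cong (_* q) (co*val≡ d) ⟨
    co d * val d * q                ≡⟨ *-assoc (co d) (val d) q ⟩
    co d * (val d * q)              ≡⟨ cong (co d *_) (image-heavy-shift (exps d) heavy) ⟨
    co d * (val (f d) * p ^ c)      ∎)
    where open ≡-Reasoning

  co-light : (d : 𝒟 n) → ¬ IsHeavy (exps d) → co (f d) * p ^ c ≡ co d * q
  co-light d light = *-cancelʳ-≡ (co (f d) * p ^ c) (co d * q) (val d) {{val≢0 d}} (begin
    co (f d) * p ^ c * val d        ≡⟨ xy∙z≈xz∙y (co (f d)) (p ^ c) (val d) ⟩
    co (f d) * val d * p ^ c        ≡⟨ cong (λ v → co (f d) * v * p ^ c) (image-light (exps d) light) ⟨
    co (f d) * val (f d) * p ^ c    ≡⟨ cong (_* p ^ c) (co*val≡ (f d)) ⟩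
    m * p ^ c                       ≡⟨ m*pᶜ≡n*q ⟩
    n * q                           ≡⟨ cong (_* q) (co*val≡ d) ⟨
    co d * val d * q                ≡⟨ xy∙z≈xz∙y (co d) (val d) q ⟩
    co d * q * val d                ∎)
    where open ≡-Reasoning

  lpf-bound : ∀ {A k} → A ∣ m → .{{NonZero A}} → A * p ^ c ≡ k * q → A * lpf k ≤ lpf A * k
  lpf-bound {A} {k} A∣m A*pᶜ≡k*q = *-cancelʳ-≤ (A * lpf k) (lpf A * k) (p ^ c) (begin
    A * lpf k * p ^ c   ≤⟨ *-monoˡ-≤ (p ^ c) (*-monoʳ-≤ A (lpf-minimal (prime⇒1< p-prime) p∣k)) ⟩
    A * p * p ^ c       ≡⟨ xy∙z≈xz∙y A p (p ^ c) ⟩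
    A * p ^ c * p       ≡⟨ cong (_* p) A*pᶜ≡k*q ⟩
    k * q * p           ≡⟨ *-assoc k q p ⟩
    k * (q * p)         ≤⟨ *-monoʳ-≤ k q*p≤lpf[A]*pᶜ ⟩
    k * (lpf A * p ^ c) ≡⟨ *-assoc k (lpf A) (p ^ c) ⟨
    k * lpf A * p ^ c   ≡⟨ cong (_* p ^ c) (*-comm k (lpf A)) ⟩
    lpf A * k * p ^ c   ∎)
    where
    open ≤-Reasoning

    p∣k : p ∣ k
    p∣k with euclidsLemma k q p-prime (subst (p ∣_) A*pᶜ≡k*q (∣-trans (m∣m^n p c≢0) (n∣m*n A)))
    ... | inj₁ p∣k = p∣k
    ... | inj₂ p∣q = contradiction (prime∣prime⇒≡ p-prime q-prime p∣q) p≢q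

    q∣A : q ∣ A
    q∣A with euclidsLemma A (p ^ c) q-prime (subst (q ∣_) (sym A*pᶜ≡k*q) (n∣m*n k))
    ... | inj₁ q∣A  = q∣A
    ... | inj₂ q∣pᶜ = contradiction (prime∣^⇒≡ c q-prime p-prime q∣pᶜ) (≢-sym p≢q)

    2≤lpf[A] : 2 ≤ lpf A
    2≤lpf[A] = 2≤lpf (≤-trans (prime⇒1< q-prime) (∣⇒≤ q∣A))

    instance
      lpf[A]≢0 : NonZero (lpf A)
      lpf[A]≢0 = >-nonZero (≤-trans (s≤s z≤n) 2≤lpf[A])

    q*p≤lpf[A]*pᶜ : q * p ≤ lpf A * p ^ c
    q*p≤lpf[A]*pᶜ with ∣pᵃqᵇ⇒p∣⊎q∣ {a = a ∸ c} {b = b + 1} p-prime q-prime 2≤lpf[A] (∣-trans (lpf∣ A) A∣m)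
    ... | inj₁ p∣lpf = ≤-trans (*-mono-≤ (<⇒≤ q<pᶜ) (∣⇒≤ p∣lpf)) (≤-reflexive (*-comm (p ^ c) (lpf A)))
    ... | inj₂ q∣lpf = *-mono-≤ (∣⇒≤ q∣lpf) (∣⇒≤ (m∣m^n p c≢0))

  f-injective : ∀ d d' → val (f d) ≡ val (f d') → val d ≡ val d'
  f-injective d d' = by-cases (isHeavy? (exps d)) (isHeavy? (exps d'))
    where
    by-cases : Dec (IsHeavy (exps d)) → Dec (IsHeavy (exps d')) → val (f d) ≡ val (f d') → val d ≡ val d'
    by-cases (yes heavy) (yes heavy') eq = *-cancelʳ-≡ (val d) (val d') q (begin
      val d * q                ≡⟨ image-heavy-shift (exps d) heavy ⟨
      val (f d) * p ^ c        ≡⟨ cong (_* p ^ c) eq ⟩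
      val (f d') * p ^ c       ≡⟨ image-heavy-shift (exps d') heavy' ⟩
      val d' * q               ∎)
      where open ≡-Reasoning
    by-cases (no light)  (no light')  eq =
      trans (sym (image-light (exps d) light)) (trans eq (image-light (exps d') light'))
    by-cases (yes heavy) (no light')  eq =
      contradiction (trans eq (image-light (exps d') light')) (heavy-image≢light (exps d) (exps d') heavy light')
    by-cases (no light)  (yes heavy') eq =
      contradiction (trans (sym eq) (image-light (exps d) light)) (heavy-image≢light (exps d') (exps d) heavy' light)

  m-odd : Odd m
  m-odd = odd-* (p ^ (a ∸ c)) (q ^ (b + 1)) (odd-^ p (a ∸ c) p-odd) (odd-^ q (b + 1) q-odd)

  f-isReducing : IsReducing n m f
  f-isReducing = record
    { cond-a  = λ d → case-a d (isHeavy? (exps d))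
    ; cond-b₁ = λ d → case-b₁ d (isHeavy? (exps d))
    ; cond-b₂ = λ d → case-b₂ d (isHeavy? (exps d))
    ; cond-c  = λ d d' related → 0 , 0 , cong (1 *_) (f-injective d d'
                  (odd-pow2Related⇒≡ (∣-odd (proj₂ (proj₂ (f d))) m-odd) (∣-odd (proj₂ (proj₂ (f d'))) m-odd) related))
    }
    where
    case-a : ∀ d → Dec (IsHeavy (exps d)) → val (f d) ≤ val d
    case-a d (yes heavy) = <⇒≤ (*-scaled-< {{val≢0 d}} (image-heavy-shift (exps d) heavy) q<pᶜ)
    case-a d (no light)  = ≤-reflexive (image-light (exps d) light)

    case-b₁ : ∀ d → Dec (IsHeavy (exps d)) → co (f d) ≤ co d
    case-b₁ d (yes heavy) = ≤-reflexive (co-heavy d heavy)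
    case-b₁ d (no light)  = <⇒≤ (*-scaled-< {{quotient≢0 (proj₂ (proj₂ d))}} (co-light d light) q<pᶜ)

    case-b₂ : ∀ d → Dec (IsHeavy (exps d)) → co (f d) * lpf (co d) ≤ lpf (co (f d)) * co d
    case-b₂ d (yes heavy) rewrite co-heavy d heavy = ≤-reflexive (*-comm (co d) (lpf (co d)))
    case-b₂ d (no light)  = lpf-bound (quotient-∣ (proj₂ (proj₂ (f d)))) {{quotient≢0 (proj₂ (proj₂ (f d)))}} (co-light d light)

lemma3p8 : (p q a b : ℕ) → Prime p → Prime q → p ≢ q →
           p % 2 ≡ 1 → q % 2 ≡ 1 →
           q < p ^ ((a + 1) / (2 + b)) →
           (p ^ a * q ^ b) reducesTo (p ^ (a ∸ (a + 1) / (2 + b)) * q ^ (b + 1))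
lemma3p8 p q a b p-prime q-prime p≢q p-odd q-odd q<pᶜ = f , f-isReducing
  where
  open Reduction p q a b ((a + 1) / (2 + b)) p-prime q-prime p≢q p-odd q-odd (m/n*n≤m (a + 1) (2 + b)) q<pᶜ
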